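{- For every integer $k\ge 1$, the graph $C_{3k+1}=\langle \mathbb{Z}_2^{3k+1},\{2k+1,2k+2,\dots,3k+1\}\rangle$ is $3$-existentially complete triangle-free.
   Context: For a set $S$ of positive integers, $\langle\mathbb{Z}_2^n,S\rangle$ denotes the graph with vertex set $\mathbb{Z}_2^n$ in which $x\sim y$ iff the Hamming distance $d(x,y)$ (number of differing coordinates) lies in $S$. A graph $G=(V,E)$ is \emph{$3$-existentially complete triangle-free} if it is triangle-free and for every $B\subseteq A\subseteq V$ with $|A|\le 3$ and $B$ independent, there exists a vertex $v\in V\setminus A$ adjacent to every vertex of $B$ and to no vertex of $A\setminus B$. -}

module Defs where

open import Data.Bool using (Bool; true; false)
open import Data.Nat using (ℕ; zero; suc; _+_; _*_; _≤_)
open import Data.Vec using (Vec; []; _∷_)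
open import Data.List using (List; length)
open import Data.List.Membership.Propositional using (_∈_; _∉_)
open import Data.List.Relation.Unary.Unique.Propositional using (Unique)
open import Data.Product using (Σ; _×_)
open import Data.Empty using (⊥)
open import Relation.Nullary using (¬_)
open import Relation.Binary.PropositionalEquality using (_≡_)

hamming : ∀ {n} → Vec Bool n → Vec Bool n → ℕ
hamming []       []       = 0
hamming (true  ∷ xs) (true  ∷ ys) = hamming xs ys
hamming (false ∷ xs) (false ∷ ys) = hamming xs ys
hamming (true  ∷ xs) (false ∷ ys) = suc (hamming xs ys)
hamming (false ∷ xs) (true  ∷ ys) = suc (hamming xs ys)

C-adj : (k : ℕ) → Vec Bool (3 * k + 1) → Vec Bool (3 * k + 1) → Set
C-adj k x y = (2 * k + 1 ≤ hamming x y) × (hamming x y ≤ 3 * k + 1)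

module _ {V : Set} (_~_ : V → V → Set) where

  TriangleFree : Set
  TriangleFree = ∀ x y z → x ~ y → y ~ z → x ~ z → ⊥

  Independent : List V → Set
  Independent B = ∀ x y → x ∈ B → y ∈ B → ¬ (x ~ y)

  ThreeExistentiallyComplete : Set
  ThreeExistentiallyComplete =
    ∀ (A B : List V) → Unique A → length A ≤ 3 →
    (∀ b → b ∈ B → b ∈ A) → Independent B →
    Σ V λ v → (v ∉ A)
              × (∀ b → b ∈ B → v ~ b)
              × (∀ a → a ∈ A → a ∉ B → ¬ (v ~ a))

  ThreeECTriangleFree : Set
  ThreeECTriangleFree = TriangleFree × ThreeExistentiallyComplete

-- Write n = 3k + 1 and x̄ for the complement of x. Since d(x̄, y) = n − d(x, y), x ~ y iff x lies
-- within k of ȳ; so x ~ y ~ z puts x and z within k of ȳ, hence within 2k of each other.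
--
-- Every requirement on the vertex v to be found is membership in a Hamming ball, and three
-- pairwise meeting balls of the cube share a point. If some b ∈ B, v is sought within k of b̄,
-- which makes it adjacent to b. Each a ∈ B asks for v within k of ā. A vertex a ∈ A ∖ B within
-- k of b̄ is then non-adjacent to v anyway and only asks for v ≠ a, i.e. for v within 3k of ā;
-- any other a ∈ A ∖ B asks for v within 2k of a, which also keeps v off a. Two members of B are
-- within 2k of each other by independence, so their balls meet; all other pairs of balls meet
-- because their radii add up to at least n − 1. If B is empty and |A| ≤ 2, a vertex outside A
-- plays the part of b. If B is empty and |A| = 3, the balls of radius 2k − 1 around the three
-- vertices meet once k ≥ 3 (for k = 2, unless two of them are antipodal), and one of the n > 3
-- neighbours of a common point avoids A. The remaining cases, k = 1 and k = 2 with an antipodal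
-- pair, are checked exhaustively after translating a vertex to 0.
module Submission where

open import Data.Bool using (Bool; true; false; not; _xor_)
open import Data.Bool.Properties using (not-¬) renaming (_≟_ to _≟ᵇ_)
open import Data.Fin as Fin using (Fin; zero; suc)
open import Data.Fin.Properties using (pigeonhole; ¬∀⟶∃¬) renaming (<⇒≢ to <⇒≢ᶠ)
open import Data.Fin.Subset.Properties using (anySubset?)
open import Data.List using (List; []; _∷_; length; map; lookup)
open import Data.List.Membership.Propositional using (_∈_; _∉_)
open import Data.List.Relation.Unary.All as All using (All; []; _∷_)
open import Data.List.Relation.Unary.All.Properties using (map⁻)
open import Data.List.Relation.Unary.AllPairs using ([]; _∷_)
open import Data.List.Relation.Unary.Any using (here; there; index)
open import Data.List.Relation.Unary.Any.Properties using (lookup-index)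
open import Data.Nat using (ℕ; zero; suc; _+_; _*_; _≤_; _<_; z≤n; s≤s; _≤?_; _<?_)
open import Data.Nat.Properties
open import Data.Nat.Tactic.RingSolver using (solve-∀)
open import Data.Product using (Σ; ∃; _×_; _,_; proj₁; proj₂; map₂)
open import Data.Vec as Vec using (Vec; []; _∷_; replicate; zipWith; _[_]%=_)
open import Data.Vec.Properties using (≡-dec; lookup∘updateAt; lookup∘updateAt′)
open import Function using (_∘_)
open import Function.Definitions using (Injective)
open import Level using (0ℓ)
open import Relation.Binary.Definitions using (DecidableEquality)
open import Relation.Binary.PropositionalEquality
open import Relation.Nullary using (¬_; Dec; yes; no; ¬?; contradiction)
open import Relation.Nullary.Decidable using (_×-dec_; _→-dec_; from-yes; decidable-stable)
open import Relation.Unary using (Pred; Decidable)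

open import Defs

sum-≤⇒< : ∀ {x y a b} → x + y ≡ a + suc b → x ≤ a → b < y
sum-≤⇒< {x} {y} {a} {b} eq x≤a = +-cancelˡ-≤ a (suc b) y (begin
  a + suc b ≡⟨ eq ⟨
  x + y     ≤⟨ +-monoˡ-≤ y x≤a ⟩
  a + y     ∎)
  where open ≤-Reasoning

sum-<⇒≤ : ∀ {x y a b} → x + y ≡ a + suc b → b < y → x ≤ a
sum-<⇒≤ {x} {y} {a} {b} eq b<y = +-cancelʳ-≤ (suc b) x a (begin
  x + suc b ≤⟨ +-monoʳ-≤ x b<y ⟩
  x + y     ≡⟨ eq ⟩
  a + suc b ∎)
  where open ≤-Reasoning

≤-pred-+-suc : ∀ {m} a b → suc m ≤ suc a + suc b → m ≤ suc a + b
≤-pred-+-suc {m} a b le = subst (m ≤_) (+-suc a b) (≤-pred le)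

3<3k+1 : ∀ {k} → 1 ≤ k → 3 < 3 * k + 1
3<3k+1 k≥1 = +-monoˡ-≤ 1 (*-monoʳ-≤ 3 k≥1)

_≟ⱽ_ : ∀ {n} → DecidableEquality (Vec Bool n)
_≟ⱽ_ = ≡-dec _≟ᵇ_

zeros ones : ∀ {n} → Vec Bool n
zeros = replicate _ false
ones  = replicate _ true

complement : ∀ {n} → Vec Bool n → Vec Bool n
complement = Vec.map not

hamming-self : ∀ {n} (x : Vec Bool n) → hamming x x ≡ 0
hamming-self []          = refl
hamming-self (true  ∷ x) = hamming-self x
hamming-self (false ∷ x) = hamming-self x

hamming-sym : ∀ {n} (x y : Vec Bool n) → hamming x y ≡ hamming y x
hamming-sym []          []          = refl
hamming-sym (true  ∷ x) (true  ∷ y) = hamming-sym x y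
hamming-sym (true  ∷ x) (false ∷ y) = cong suc (hamming-sym x y)
hamming-sym (false ∷ x) (true  ∷ y) = cong suc (hamming-sym x y)
hamming-sym (false ∷ x) (false ∷ y) = hamming-sym x y

hamming≤n : ∀ {n} (x y : Vec Bool n) → hamming x y ≤ n
hamming≤n []          []          = z≤n
hamming≤n (true  ∷ x) (true  ∷ y) = m≤n⇒m≤1+n (hamming≤n x y)
hamming≤n (true  ∷ x) (false ∷ y) = s≤s (hamming≤n x y)
hamming≤n (false ∷ x) (true  ∷ y) = s≤s (hamming≤n x y)
hamming≤n (false ∷ x) (false ∷ y) = m≤n⇒m≤1+n (hamming≤n x y)

hamming-triangle : ∀ {n} (x y z : Vec Bool n) → hamming x z ≤ hamming x y + hamming y z
hamming-triangle [] [] [] = z≤n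
hamming-triangle (true  ∷ x) (true  ∷ y) (true  ∷ z) = hamming-triangle x y z
hamming-triangle (false ∷ x) (false ∷ y) (false ∷ z) = hamming-triangle x y z
hamming-triangle (true  ∷ x) (false ∷ y) (false ∷ z) = s≤s (hamming-triangle x y z)
hamming-triangle (false ∷ x) (true  ∷ y) (true  ∷ z) = s≤s (hamming-triangle x y z)
hamming-triangle (true  ∷ x) (true  ∷ y) (false ∷ z) =
  ≤-trans (s≤s (hamming-triangle x y z)) (≤-reflexive (sym (+-suc _ _)))
hamming-triangle (false ∷ x) (false ∷ y) (true  ∷ z) =
  ≤-trans (s≤s (hamming-triangle x y z)) (≤-reflexive (sym (+-suc _ _)))
hamming-triangle (true  ∷ x) (false ∷ y) (true  ∷ z) =
  ≤-trans (hamming-triangle x y z) (m≤n⇒m≤1+n (+-monoʳ-≤ _ (n≤1+n _)))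
hamming-triangle (false ∷ x) (true  ∷ y) (false ∷ z) =
  ≤-trans (hamming-triangle x y z) (m≤n⇒m≤1+n (+-monoʳ-≤ _ (n≤1+n _)))

≢⇒hamming-pos : ∀ {n} {x y : Vec Bool n} → x ≢ y → 0 < hamming x y
≢⇒hamming-pos {x = []}        {[]}        x≢y = contradiction refl x≢y
≢⇒hamming-pos {x = true  ∷ x} {true  ∷ y} x≢y = ≢⇒hamming-pos (x≢y ∘ cong (true ∷_))
≢⇒hamming-pos {x = false ∷ x} {false ∷ y} x≢y = ≢⇒hamming-pos (x≢y ∘ cong (false ∷_))
≢⇒hamming-pos {x = true  ∷ x} {false ∷ y} _   = s≤s z≤n
≢⇒hamming-pos {x = false ∷ x} {true  ∷ y} _   = s≤s z≤n

hamming-pos⇒≢ : ∀ {n} {x y : Vec Bool n} → 0 < hamming x y → x ≢ y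
hamming-pos⇒≢ {x = x} pos refl = <⇒≢ pos (sym (hamming-self x))

hamming-complement : ∀ {n} (x y : Vec Bool n) → hamming (complement x) y + hamming x y ≡ n
hamming-complement []          []          = refl
hamming-complement (true  ∷ x) (true  ∷ y) = cong suc (hamming-complement x y)
hamming-complement (false ∷ x) (false ∷ y) = cong suc (hamming-complement x y)
hamming-complement (true  ∷ x) (false ∷ y) = trans (+-suc _ _) (cong suc (hamming-complement x y))
hamming-complement (false ∷ x) (true  ∷ y) = trans (+-suc _ _) (cong suc (hamming-complement x y))

hamming-complement-both : ∀ {n} (x y : Vec Bool n) → hamming (complement x) (complement y) ≡ hamming x y
hamming-complement-both []          []          = refl
hamming-complement-both (true  ∷ x) (true  ∷ y) = hamming-complement-both x y
hamming-complement-both (true  ∷ x) (false ∷ y) = cong suc (hamming-complement-both x y)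
hamming-complement-both (false ∷ x) (true  ∷ y) = cong suc (hamming-complement-both x y)
hamming-complement-both (false ∷ x) (false ∷ y) = hamming-complement-both x y

≢complement⇒hamming< : ∀ {n} (x y : Vec Bool n) → y ≢ complement x → hamming x y < n
≢complement⇒hamming< x y y≢x̄ = ≤∧≢⇒< (hamming≤n x y) (y≢x̄ ∘ hamming≡n⇒complement x y)
  where
    hamming≡n⇒complement : ∀ {n} (x y : Vec Bool n) → hamming x y ≡ n → y ≡ complement x
    hamming≡n⇒complement []          []          _  = refl
    hamming≡n⇒complement (true  ∷ x) (false ∷ y) eq = cong (false ∷_) (hamming≡n⇒complement x y (suc-injective eq))
    hamming≡n⇒complement (false ∷ x) (true  ∷ y) eq = cong (true ∷_) (hamming≡n⇒complement x y (suc-injective eq))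
    hamming≡n⇒complement (true  ∷ x) (true  ∷ y) eq = contradiction (subst (_≤ _) eq (hamming≤n x y)) 1+n≰n
    hamming≡n⇒complement (false ∷ x) (false ∷ y) eq = contradiction (subst (_≤ _) eq (hamming≤n x y)) 1+n≰n

translate : ∀ {n} → Vec Bool n → Vec Bool n → Vec Bool n
translate = zipWith _xor_

hamming-translate : ∀ {n} (t x y : Vec Bool n) → hamming (translate t x) (translate t y) ≡ hamming x y
hamming-translate []          []          []          = refl
hamming-translate (false ∷ t) (true  ∷ x) (true  ∷ y) = hamming-translate t x y
hamming-translate (false ∷ t) (true  ∷ x) (false ∷ y) = cong suc (hamming-translate t x y)
hamming-translate (false ∷ t) (false ∷ x) (true  ∷ y) = cong suc (hamming-translate t x y)
hamming-translate (false ∷ t) (false ∷ x) (false ∷ y) = hamming-translate t x y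
hamming-translate (true  ∷ t) (true  ∷ x) (true  ∷ y) = hamming-translate t x y
hamming-translate (true  ∷ t) (true  ∷ x) (false ∷ y) = cong suc (hamming-translate t x y)
hamming-translate (true  ∷ t) (false ∷ x) (true  ∷ y) = cong suc (hamming-translate t x y)
hamming-translate (true  ∷ t) (false ∷ x) (false ∷ y) = hamming-translate t x y

translate-involutive : ∀ {n} (t x : Vec Bool n) → translate t (translate t x) ≡ x
translate-involutive []          []          = refl
translate-involutive (false ∷ t) (b     ∷ x) = cong (b ∷_) (translate-involutive t x)
translate-involutive (true  ∷ t) (true  ∷ x) = cong (true ∷_) (translate-involutive t x)
translate-involutive (true  ∷ t) (false ∷ x) = cong (false ∷_) (translate-involutive t x)

translate-injective : ∀ {n} (t : Vec Bool n) → Injective _≡_ _≡_ (translate t)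
translate-injective t {x} {y} eq = begin
  x                             ≡⟨ translate-involutive t x ⟨
  translate t (translate t x)   ≡⟨ cong (translate t) eq ⟩
  translate t (translate t y)   ≡⟨ translate-involutive t y ⟩
  y                             ∎
  where open ≡-Reasoning

translate-self : ∀ {n} (t : Vec Bool n) → translate t t ≡ zeros
translate-self []          = refl
translate-self (true  ∷ t) = cong (false ∷_) (translate-self t)
translate-self (false ∷ t) = cong (false ∷_) (translate-self t)

translate-complement : ∀ {n} (t : Vec Bool n) → translate t (complement t) ≡ ones
translate-complement []          = refl
translate-complement (true  ∷ t) = cong (true ∷_) (translate-complement t)
translate-complement (false ∷ t) = cong (true ∷_) (translate-complement t)

flip : ∀ {n} → Fin n → Vec Bool n → Vec Bool n
flip i u = u [ i ]%= not

hamming-flip : ∀ {n} (i : Fin n) (u : Vec Bool n) → hamming u (flip i u) ≡ 1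
hamming-flip zero    (true  ∷ u) = cong suc (hamming-self u)
hamming-flip zero    (false ∷ u) = cong suc (hamming-self u)
hamming-flip (suc i) (true  ∷ u) = hamming-flip i u
hamming-flip (suc i) (false ∷ u) = hamming-flip i u

hamming-flip-≤ : ∀ {n} (i : Fin n) (a u : Vec Bool n) → hamming a (flip i u) ≤ suc (hamming a u)
hamming-flip-≤ i a u = begin
  hamming a (flip i u)                    ≤⟨ hamming-triangle a u (flip i u) ⟩
  hamming a u + hamming u (flip i u)      ≡⟨ cong (hamming a u +_) (hamming-flip i u) ⟩
  hamming a u + 1                         ≡⟨ +-comm (hamming a u) 1 ⟩
  suc (hamming a u)                       ∎
  where open ≤-Reasoning

flip-injective : ∀ {n} (u : Vec Bool n) → Injective _≡_ _≡_ (λ i → flip i u)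
flip-injective u {i} {j} eq with i Fin.≟ j
... | yes i≡j = i≡j
... | no  i≢j = contradiction (sym ith-entry) (not-¬ refl)
  where
    ith-entry : not (Vec.lookup u i) ≡ Vec.lookup u i
    ith-entry = trans (sym (lookup∘updateAt i u))
                      (trans (cong (λ w → Vec.lookup w i) eq) (lookup∘updateAt′ i j i≢j u))

module _ {A : Set} (_≟_ : DecidableEquality A) where
  open import Data.List.Membership.DecPropositional _≟_ using (_∈?_)

  injection-escapes : ∀ {m} {f : Fin m → A} → Injective _≡_ _≡_ f →
                      (ps : List A) → length ps < m → ∃ λ i → f i ∉ ps
  injection-escapes {m} {f} f-injective ps short =
    ¬∀⟶∃¬ m (λ i → f i ∈ ps) (λ i → f i ∈? ps) not-covered
    where
      not-covered : ¬ (∀ i → f i ∈ ps)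
      not-covered covered with pigeonhole short (λ i → index (covered i))
      ... | i , j , i<j , same-index = <⇒≢ᶠ i<j (f-injective (begin
        f i                          ≡⟨ lookup-index (covered i) ⟩
        lookup ps (index (covered i)) ≡⟨ cong (lookup ps) same-index ⟩
        lookup ps (index (covered j)) ≡⟨ lookup-index (covered j) ⟨
        f j                          ∎))
        where open ≡-Reasoning

flip-escapes : ∀ {n} (u : Vec Bool n) (ps : List (Vec Bool n)) → length ps < n → ∃ λ i → flip i u ∉ ps
flip-escapes u = injection-escapes _≟ⱽ_ (flip-injective u)

record Ball (n : ℕ) : Set where
  constructor ball
  field
    centre : Vec Bool n
    radius : ℕ
open Ball

_∈ᴮ_ : ∀ {n} → Vec Bool n → Ball n → Set
v ∈ᴮ β = hamming (centre β) v ≤ radius β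

Meet : ∀ {n} → Ball n → Ball n → Set
Meet β γ = hamming (centre β) (centre γ) ≤ radius β + radius γ

meet-sym : ∀ {n} (β γ : Ball n) → Meet β γ → Meet γ β
meet-sym β γ meet = subst₂ _≤_ (hamming-sym (centre β) (centre γ)) (+-comm (radius β) (radius γ)) meet

meet-by-size : ∀ {n} (β γ : Ball n) → n ≤ radius β + radius γ → Meet β γ
meet-by-size β γ = ≤-trans (hamming≤n (centre β) (centre γ))

-- The common point follows the majority of the three centres; a coordinate on which one
-- centre is outvoted is charged to that centre's radius, and a centre whose radius is used
-- up is itself a common point.
helly₃ : ∀ {n} (β₁ β₂ β₃ : Ball n) → Meet β₁ β₂ → Meet β₁ β₃ → Meet β₂ β₃ →
         ∃ λ v → v ∈ᴮ β₁ × v ∈ᴮ β₂ × v ∈ᴮ β₃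
helly₃ (ball x zero) (ball y β) (ball z γ) p q r =
  x , ≤-reflexive (hamming-self x) , subst (_≤ β) (hamming-sym x y) p , subst (_≤ γ) (hamming-sym x z) q
helly₃ (ball x (suc α)) (ball y zero) (ball z γ) p q r =
  y , subst (hamming x y ≤_) (+-identityʳ _) p , ≤-reflexive (hamming-self y) , subst (_≤ γ) (hamming-sym y z) r
helly₃ (ball x (suc α)) (ball y (suc β)) (ball z zero) p q r =
  z , subst (hamming x z ≤_) (+-identityʳ _) q , subst (hamming y z ≤_) (+-identityʳ _) r , ≤-reflexive (hamming-self z)
helly₃ (ball [] (suc α)) (ball [] (suc β)) (ball [] (suc γ)) p q r = [] , z≤n , z≤n , z≤n
helly₃ (ball (b ∷ x) (suc α)) (ball (c ∷ y) (suc β)) (ball (d ∷ z) (suc γ)) p q r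
  with b | c | d
... | true | true | true
    with v , v₁ , v₂ , v₃ ← helly₃ (ball x (suc α)) (ball y (suc β)) (ball z (suc γ)) p q r
    = true ∷ v , v₁ , v₂ , v₃
... | false | false | false
    with v , v₁ , v₂ , v₃ ← helly₃ (ball x (suc α)) (ball y (suc β)) (ball z (suc γ)) p q r
    = false ∷ v , v₁ , v₂ , v₃
... | true | false | false
    with v , v₁ , v₂ , v₃ ← helly₃ (ball x α) (ball y (suc β)) (ball z (suc γ)) (≤-pred p) (≤-pred q) r
    = false ∷ v , s≤s v₁ , v₂ , v₃
... | false | true | true
    with v , v₁ , v₂ , v₃ ← helly₃ (ball x α) (ball y (suc β)) (ball z (suc γ)) (≤-pred p) (≤-pred q) r
    = true ∷ v , s≤s v₁ , v₂ , v₃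
... | false | true | false
    with v , v₁ , v₂ , v₃ ← helly₃ (ball x (suc α)) (ball y β) (ball z (suc γ)) (≤-pred-+-suc α β p) q (≤-pred r)
    = false ∷ v , v₁ , s≤s v₂ , v₃
... | true | false | true
    with v , v₁ , v₂ , v₃ ← helly₃ (ball x (suc α)) (ball y β) (ball z (suc γ)) (≤-pred-+-suc α β p) q (≤-pred r)
    = true ∷ v , v₁ , s≤s v₂ , v₃
... | false | false | true
    with v , v₁ , v₂ , v₃ ← helly₃ (ball x (suc α)) (ball y (suc β)) (ball z γ) p (≤-pred-+-suc α γ q) (≤-pred-+-suc β γ r)
    = false ∷ v , v₁ , v₂ , s≤s v₃
... | true | true | false
    with v , v₁ , v₂ , v₃ ← helly₃ (ball x (suc α)) (ball y (suc β)) (ball z γ) p (≤-pred-+-suc α γ q) (≤-pred-+-suc β γ r)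
    = true ∷ v , v₁ , v₂ , s≤s v₃

helly : ∀ {n} {X : Set} (β : X → Ball n) (xs : List X) → length xs ≤ 3 →
        (∀ {x y} → x ∈ xs → y ∈ xs → Meet (β x) (β y)) →
        ∃ λ v → All (λ x → v ∈ᴮ β x) xs
helly β [] _ _ = zeros , []
helly β (x ∷ []) _ meet =
  let v , v₁ , _ = helly₃ (β x) (β x) (β x) (meet x₀ x₀) (meet x₀ x₀) (meet x₀ x₀)
  in  v , v₁ ∷ []
  where x₀ = here refl
helly β (x ∷ y ∷ []) _ meet =
  let v , v₁ , v₂ , _ = helly₃ (β x) (β y) (β y) (meet x₀ x₁) (meet x₀ x₁) (meet x₁ x₁)
  in  v , v₁ ∷ v₂ ∷ []
  where x₀ = here refl
        x₁ = there (here refl)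
helly β (x ∷ y ∷ z ∷ []) _ meet =
  let v , v₁ , v₂ , v₃ = helly₃ (β x) (β y) (β z) (meet x₀ x₁) (meet x₀ x₂) (meet x₁ x₂)
  in  v , v₁ ∷ v₂ ∷ v₃ ∷ []
  where x₀ = here refl
        x₁ = there (here refl)
        x₂ = there (there (here refl))
helly β (_ ∷ _ ∷ _ ∷ _ ∷ _) (s≤s (s≤s (s≤s ()))) _

Near : ∀ {n} → ℕ → Vec Bool n → Vec Bool n → Set
Near r v a = 0 < hamming a v × hamming a v ≤ r

near? : ∀ {n} r (v a : Vec Bool n) → Dec (Near r v a)
near? r v a = (0 <? hamming a v) ×-dec (hamming a v ≤? r)

translate-near : ∀ {n r} (t : Vec Bool n) {v a} → Near r v (translate t a) → Near r (translate t v) a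
translate-near {r = r} t {v} {a} = subst (λ d → 0 < d × d ≤ r) (begin
  hamming (translate t a) v                           ≡⟨ cong (hamming (translate t a)) (translate-involutive t v) ⟨
  hamming (translate t a) (translate t (translate t v)) ≡⟨ hamming-translate t a (translate t v) ⟩
  hamming a (translate t v)                           ∎)
  where open ≡-Reasoning

translate-back : ∀ {n r} (t : Vec Bool n) {A} →
                 (∃ λ v → All (Near r v) (map (translate t) A)) → ∃ λ v → All (Near r v) A
translate-back t (v , near) = translate t v , All.map (translate-near t) (map⁻ near)

avoiding⇒near : ∀ {n r} {w : Vec Bool n} {A} → w ∉ A → All (λ a → hamming a w ≤ r) A → All (Near r w) A
avoiding⇒near w∉A []       = []
avoiding⇒near w∉A (p ∷ ps) = (≢⇒hamming-pos (w∉A ∘ here ∘ sym) , p) ∷ avoiding⇒near (w∉A ∘ there) ps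

near-point-of-close-triple :
  ∀ {n} R (a₁ a₂ a₃ : Vec Bool n) → 3 < n →
  hamming a₁ a₂ ≤ R + R → hamming a₁ a₃ ≤ R + R → hamming a₂ a₃ ≤ R + R →
  ∃ λ v → All (Near (suc R) v) (a₁ ∷ a₂ ∷ a₃ ∷ [])
near-point-of-close-triple R a₁ a₂ a₃ 3<n p q r
  with u , u₁ , u₂ , u₃ ← helly₃ (ball a₁ R) (ball a₂ R) (ball a₃ R) p q r
  with i , escapes ← flip-escapes u (a₁ ∷ a₂ ∷ a₃ ∷ []) 3<n
  = flip i u , avoiding⇒near escapes (All.map (λ {a} close → ≤-trans (hamming-flip-≤ i a u) (s≤s close))
                                              (u₁ ∷ u₂ ∷ u₃ ∷ []))

∀-vec? : ∀ {n} {P : Pred (Vec Bool n) 0ℓ} → Decidable P → Dec (∀ v → P v)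
∀-vec? P? with anySubset? (¬? ∘ P?)
... | yes (v , ¬Pv) = no λ ∀P → ¬Pv (∀P v)
... | no  ∄¬P       = yes λ v → decidable-stable (P? v) (λ ¬Pv → ∄¬P (v , ¬Pv))

near-point-Q₄ : ∀ {x} (y z : Vec Bool 4) → x ≡ zeros → x ≢ y → x ≢ z → y ≢ z →
                ∃ λ v → All (Near 2 v) (x ∷ y ∷ z ∷ [])
near-point-Q₄ y z refl = from-yes (∀-vec? λ (y : Vec Bool 4) → ∀-vec? λ (z : Vec Bool 4) →
  ¬? (zeros ≟ⱽ y) →-dec ¬? (zeros ≟ⱽ z) →-dec ¬? (y ≟ⱽ z) →-dec
  anySubset? λ v → All.all? (near? 2 v) (zeros ∷ y ∷ z ∷ [])) y z

near-point-antipodal-Q₇ : ∀ {x y} (z : Vec Bool 7) → x ≡ zeros → y ≡ ones → x ≢ z → y ≢ z →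
                          ∃ λ v → All (Near 4 v) (x ∷ y ∷ z ∷ [])
near-point-antipodal-Q₇ z refl refl = from-yes (∀-vec? λ (z : Vec Bool 7) →
  ¬? (zeros ≟ⱽ z) →-dec ¬? (ones ≟ⱽ z) →-dec
  anySubset? λ v → All.all? (near? 4 v) (zeros ∷ ones ∷ z ∷ [])) z

near-point-Q₇ : (a₁ a₂ a₃ : Vec Bool 7) → a₁ ≢ a₂ → a₁ ≢ a₃ → a₂ ≢ a₃ →
                ∃ λ v → All (Near 4 v) (a₁ ∷ a₂ ∷ a₃ ∷ [])
near-point-Q₇ a₁ a₂ a₃ a₁≢a₂ a₁≢a₃ a₂≢a₃
  with a₂ ≟ⱽ complement a₁ | a₃ ≟ⱽ complement a₁ | a₃ ≟ⱽ complement a₂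
... | yes refl | _ | _ =
  translate-back a₁ (near-point-antipodal-Q₇ (translate a₁ a₃) (translate-self a₁) (translate-complement a₁)
                                              (a₁≢a₃ ∘ translate-injective a₁) (a₂≢a₃ ∘ translate-injective a₁))
... | no _ | yes refl | _ =
  swap₂₃ (translate-back a₁ (near-point-antipodal-Q₇ (translate a₁ a₂) (translate-self a₁) (translate-complement a₁)
                                                     (a₁≢a₂ ∘ translate-injective a₁) (a₂≢a₃ ∘ sym ∘ translate-injective a₁)))
  where
    swap₂₃ : ∀ {n r} {x y z : Vec Bool n} →
             (∃ λ v → All (Near r v) (x ∷ y ∷ z ∷ [])) → ∃ λ v → All (Near r v) (x ∷ z ∷ y ∷ [])
    swap₂₃ (v , p ∷ q ∷ s ∷ []) = v , p ∷ s ∷ q ∷ []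
... | no _ | no _ | yes refl =
  rotate (translate-back a₂ (near-point-antipodal-Q₇ (translate a₂ a₁) (translate-self a₂) (translate-complement a₂)
                                                     (a₁≢a₂ ∘ sym ∘ translate-injective a₂) (a₁≢a₃ ∘ sym ∘ translate-injective a₂)))
  where
    rotate : ∀ {n r} {x y z : Vec Bool n} →
             (∃ λ v → All (Near r v) (y ∷ z ∷ x ∷ [])) → ∃ λ v → All (Near r v) (x ∷ y ∷ z ∷ [])
    rotate (v , q ∷ s ∷ p ∷ []) = v , p ∷ q ∷ s ∷ []
... | no a₂≢ā₁ | no a₃≢ā₁ | no a₃≢ā₂ =
  near-point-of-close-triple 3 a₁ a₂ a₃ (3<3k+1 {2} (s≤s z≤n))
    (≤-pred (≢complement⇒hamming< a₁ a₂ a₂≢ā₁))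
    (≤-pred (≢complement⇒hamming< a₁ a₃ a₃≢ā₁))
    (≤-pred (≢complement⇒hamming< a₂ a₃ a₃≢ā₂))

near-point : ∀ k → 1 ≤ k → (a₁ a₂ a₃ : Vec Bool (3 * k + 1)) → a₁ ≢ a₂ → a₁ ≢ a₃ → a₂ ≢ a₃ →
             ∃ λ v → All (Near (2 * k) v) (a₁ ∷ a₂ ∷ a₃ ∷ [])
near-point 1 _ a₁ a₂ a₃ a₁≢a₂ a₁≢a₃ a₂≢a₃ =
  translate-back a₁ (near-point-Q₄ (translate a₁ a₂) (translate a₁ a₃) (translate-self a₁)
                                    (a₁≢a₂ ∘ translate-injective a₁) (a₁≢a₃ ∘ translate-injective a₁)
                                    (a₂≢a₃ ∘ translate-injective a₁))
near-point 2 _ = near-point-Q₇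
near-point (suc (suc (suc j))) k≥1 a₁ a₂ a₃ _ _ _ =
  subst (λ r → ∃ λ v → All (Near r v) (a₁ ∷ a₂ ∷ a₃ ∷ [])) (1+R≡2k j)
        (near-point-of-close-triple R a₁ a₂ a₃ (3<3k+1 k≥1) (wide a₁ a₂) (wide a₁ a₃) (wide a₂ a₃))
  where
    R : ℕ
    R = 2 * j + 5
    1+R≡2k : ∀ j → suc (2 * j + 5) ≡ 2 * (3 + j)
    1+R≡2k = solve-∀
    n+j≡R+R : ∀ j → 3 * (3 + j) + 1 + j ≡ (2 * j + 5) + (2 * j + 5)
    n+j≡R+R = solve-∀
    wide : (x y : Vec Bool (3 * (3 + j) + 1)) → hamming x y ≤ R + R
    wide x y = ≤-trans (hamming≤n x y) (subst (3 * (3 + j) + 1 ≤_) (n+j≡R+R j) (m≤m+n _ j))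

module _ (k : ℕ) where

  private
    V : Set
    V = Vec Bool (3 * k + 1)

    2k≡k+k : 2 * k ≡ k + k
    2k≡k+k = cong (k +_) (+-identityʳ k)

    n≡k+[1+2k] : 3 * k + 1 ≡ k + suc (2 * k)
    n≡k+[1+2k] = lemma k
      where lemma : ∀ k → 3 * k + 1 ≡ k + suc (2 * k)
            lemma = solve-∀

    n≡[k+2k]+1 : 3 * k + 1 ≡ (k + 2 * k) + 1
    n≡[k+2k]+1 = lemma k
      where lemma : ∀ k → 3 * k + 1 ≡ (k + 2 * k) + 1
            lemma = solve-∀

    n≤k+3k : 1 ≤ k → 3 * k + 1 ≤ k + 3 * k
    n≤k+3k k≥1 = subst (3 * k + 1 ≤_) (+-comm (3 * k) k) (+-monoʳ-≤ (3 * k) k≥1)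

    n≤2k+2k : 1 ≤ k → 3 * k + 1 ≤ 2 * k + 2 * k
    n≤2k+2k k≥1 = subst (3 * k + 1 ≤_) (lemma k) (+-monoʳ-≤ (3 * k) k≥1)
      where lemma : ∀ k → 3 * k + k ≡ 2 * k + 2 * k
            lemma = solve-∀

  far⇒adjacent : (x y : V) → 2 * k < hamming x y → C-adj k x y
  far⇒adjacent x y far = subst (_≤ hamming x y) (+-comm 1 (2 * k)) far , hamming≤n x y

  adjacent⇒far : (x y : V) → C-adj k x y → 2 * k < hamming x y
  adjacent⇒far x y (far , _) = subst (_≤ hamming x y) (+-comm (2 * k) 1) far

  close⇒¬adjacent : (x y : V) → hamming x y ≤ 2 * k → ¬ C-adj k x y
  close⇒¬adjacent x y close adjacent = <⇒≱ (adjacent⇒far x y adjacent) close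

  ¬adjacent⇒close : (x y : V) → ¬ C-adj k x y → hamming x y ≤ 2 * k
  ¬adjacent⇒close x y ¬adjacent = ≮⇒≥ (¬adjacent ∘ far⇒adjacent x y)

  adjacent-sym : (x y : V) → C-adj k x y → C-adj k y x
  adjacent-sym x y = far⇒adjacent y x ∘ subst (2 * k <_) (hamming-sym x y) ∘ adjacent⇒far x y

  adjacent⇒≢ : (x y : V) → C-adj k x y → x ≢ y
  adjacent⇒≢ x _ adjacent refl = close⇒¬adjacent x x (subst (_≤ 2 * k) (sym (hamming-self x)) z≤n) adjacent

  near-complement⇒adjacent : (x y : V) → hamming (complement y) x ≤ k → C-adj k x y
  near-complement⇒adjacent x y near = adjacent-sym y x (far⇒adjacent y x
    (sum-≤⇒< (trans (hamming-complement y x) n≡k+[1+2k]) near))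

  adjacent⇒near-complement : (x y : V) → C-adj k x y → hamming (complement y) x ≤ k
  adjacent⇒near-complement x y adjacent =
    sum-<⇒≤ (trans (hamming-complement y x) n≡k+[1+2k]) (adjacent⇒far y x (adjacent-sym x y adjacent))

  C-triangle-free : TriangleFree (C-adj k)
  C-triangle-free x y z x~y y~z = close⇒¬adjacent x z (begin
    hamming x z                                         ≤⟨ hamming-triangle x (complement y) z ⟩
    hamming x (complement y) + hamming (complement y) z ≤⟨ +-mono-≤ x-near-ȳ z-near-ȳ ⟩
    k + k                                               ≡⟨ 2k≡k+k ⟨
    2 * k                                               ∎)
    where
      open ≤-Reasoning
      x-near-ȳ : hamming x (complement y) ≤ k
      x-near-ȳ = subst (_≤ k) (hamming-sym (complement y) x) (adjacent⇒near-complement x y x~y)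
      z-near-ȳ : hamming (complement y) z ≤ k
      z-near-ȳ = adjacent⇒near-complement z y (adjacent-sym y z y~z)

  Separates : List V → List V → V → Set
  Separates A B v = v ∉ A × (∀ b → b ∈ B → C-adj k v b) × (∀ a → a ∈ A → a ∉ B → ¬ C-adj k v a)

  module _ (B : List V) where
    open import Data.List.Membership.DecPropositional (_≟ⱽ_ {3 * k + 1}) using (_∈?_)

    Realises : V → V → Set
    Realises v a = (a ∈ B → C-adj k v a) × (a ∉ B → ¬ C-adj k v a) × v ≢ a

    realises⇒separates : ∀ {A v} → (∀ b → b ∈ B → b ∈ A) → All (Realises v) A → Separates A B v
    realises⇒separates B⊆A realises =
      (λ v∈A → proj₂ (proj₂ (All.lookup realises v∈A)) refl) ,
      (λ b b∈B → proj₁ (All.lookup realises (B⊆A b b∈B)) b∈B) ,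
      (λ a a∈A a∉B → proj₁ (proj₂ (All.lookup realises a∈A)) a∉B)

    demand : (b a : V) → Dec (a ∈ B) → Dec (hamming (complement b) a ≤ k) → Ball (3 * k + 1)
    demand b a (yes _) _       = ball (complement a) k
    demand b a (no _)  (yes _) = ball (complement a) (3 * k)
    demand b a (no _)  (no _)  = ball a (2 * k)

    demand-of-member : ∀ {b a v} (m : Dec (a ∈ B)) f → a ∈ B → v ∈ᴮ demand b a m f →
                       hamming (complement a) v ≤ k
    demand-of-member (yes _) _ _   v∈ = v∈
    demand-of-member (no a∉B) _ a∈B _ = contradiction a∈B a∉B

    demand-sound : ∀ {v} b a m f → hamming (complement b) v ≤ k → v ∈ᴮ demand b a m f → Realises v a
    demand-sound {v} b a (yes a∈B) _ _ v∈ =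
      (λ _ → adjacent) , (λ a∉B → contradiction a∈B a∉B) , adjacent⇒≢ v a adjacent
      where adjacent = near-complement⇒adjacent v a v∈
    demand-sound {v} b a (no a∉B) (yes b̄-near-a) v-near-b̄ v∈ =
      (λ a∈B → contradiction a∈B a∉B) , (λ _ → close⇒¬adjacent v a v-close-a) ,
      hamming-pos⇒≢ (sum-≤⇒< (hamming-complement a v) v∈) ∘ sym
      where
        open ≤-Reasoning
        v-near-b̄′ : hamming v (complement b) ≤ k
        v-near-b̄′ = subst (_≤ k) (hamming-sym (complement b) v) v-near-b̄
        v-close-a : hamming v a ≤ 2 * k
        v-close-a = begin
          hamming v a                                         ≤⟨ hamming-triangle v (complement b) a ⟩
          hamming v (complement b) + hamming (complement b) a ≤⟨ +-mono-≤ v-near-b̄′ b̄-near-a ⟩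
          k + k                                               ≡⟨ 2k≡k+k ⟨
          2 * k                                               ∎
    demand-sound {v} b a (no a∉B) (no b̄-far-a) v-near-b̄ v∈ =
      (λ a∈B → contradiction a∈B a∉B) ,
      (λ _ → close⇒¬adjacent v a (subst (_≤ 2 * k) (hamming-sym a v) v∈)) ,
      (λ { refl → b̄-far-a v-near-b̄ })

    member-meets-nonmember : 1 ≤ k → ∀ b a a' (p : a ∈ B) (p' : a' ∉ B) f f' →
                             Meet (demand b a (yes p) f) (demand b a' (no p') f')
    member-meets-nonmember k≥1 b a a' _ _ _ (yes _) =
      meet-by-size (ball (complement a) k) (ball (complement a') (3 * k)) (n≤k+3k k≥1)
    member-meets-nonmember k≥1 b a a' p p' _ (no _) =
      sum-<⇒≤ (trans (hamming-complement a a') n≡[k+2k]+1) (≢⇒hamming-pos λ a≡a' → p' (subst (_∈ B) a≡a' p))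

    demands-meet : 1 ≤ k → (∀ {a a'} → a ∈ B → a' ∈ B → hamming a a' ≤ 2 * k) →
                   ∀ b a a' m m' f f' → Meet (demand b a m f) (demand b a' m' f')
    demands-meet _ B-close b a a' (yes p) (yes p') _ _ = begin
      hamming (complement a) (complement a') ≡⟨ hamming-complement-both a a' ⟩
      hamming a a'                           ≤⟨ B-close p p' ⟩
      2 * k                                  ≡⟨ 2k≡k+k ⟩
      k + k                                  ∎
      where open ≤-Reasoning
    demands-meet k≥1 _ b a a' (yes p) (no p') f f' = member-meets-nonmember k≥1 b a a' p p' f f'
    demands-meet k≥1 _ b a a' (no p) (yes p') f f' =
      meet-sym (demand b a' (yes p') f') (demand b a (no p) f) (member-meets-nonmember k≥1 b a' a p' p f' f)
    demands-meet k≥1 _ b a a' (no p) (no p') f f' =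
      meet-by-size (demand b a (no p) f) (demand b a' (no p') f')
                   (≤-trans (n≤2k+2k k≥1) (+-mono-≤ (nonmember-radius a p f) (nonmember-radius a' p' f')))
      where
        nonmember-radius : ∀ a (p : a ∉ B) f → 2 * k ≤ radius (demand b a (no p) f)
        nonmember-radius _ _ (yes _) = *-monoˡ-≤ k (n≤1+n 2)
        nonmember-radius _ _ (no _)  = ≤-refl

    anchored-separation : 1 ≤ k → Independent (C-adj k) B → ∀ {b} → b ∈ B →
                          ∀ A → length A ≤ 3 → (∀ b → b ∈ B → b ∈ A) → Σ V (Separates A B)
    anchored-separation k≥1 independent {b} b∈B A short B⊆A =
      let v , in-demands = helly demand-for A short λ {a} {a'} _ _ →
                             demands-meet k≥1 B-close b a a' (a ∈? B) (a' ∈? B) (b̄-near? a) (b̄-near? a')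
          v-near-b̄      = demand-of-member (b ∈? B) (b̄-near? b) b∈B (All.lookup in-demands (B⊆A b b∈B))
      in  v , realises⇒separates B⊆A
                (All.map (λ {a} → demand-sound b a (a ∈? B) (b̄-near? a) v-near-b̄) in-demands)
      where
        b̄-near? : ∀ a → Dec (hamming (complement b) a ≤ k)
        b̄-near? a = hamming (complement b) a ≤? k
        demand-for : V → Ball (3 * k + 1)
        demand-for a = demand b a (a ∈? B) (b̄-near? a)
        B-close : ∀ {a a'} → a ∈ B → a' ∈ B → hamming a a' ≤ 2 * k
        B-close {a} {a'} a∈B a'∈B = ¬adjacent⇒close a a' (independent a a' a∈B a'∈B)

  near⇒separates : ∀ {A v} → All (Near (2 * k) v) A → Separates A [] v
  near⇒separates {v = v} near =
    (λ v∈A → hamming-pos⇒≢ {x = v} {v} (proj₁ (All.lookup near v∈A)) refl) ,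
    (λ _ ()) ,
    (λ a a∈A _ → close⇒¬adjacent v a (subst (_≤ 2 * k) (hamming-sym a v) (proj₂ (All.lookup near a∈A))))

  phantom-separation : 1 ≤ k → (A : List V) → length A ≤ 2 → Σ V (Separates A [])
  phantom-separation k≥1 A short =
    let i , b∉A                = flip-escapes zeros A (≤-trans (s≤s short) (<⇒≤ (3<3k+1 k≥1)))
        b                      = flip i zeros
        v , v∉b∷A , _ , avoids = anchored-separation (b ∷ []) k≥1 (singleton-independent b) (here refl)
                                                     (b ∷ A) (s≤s short) (λ { _ (here refl) → here refl })
    in  v , v∉b∷A ∘ there , (λ _ ()) , λ a a∈A _ → avoids a (there a∈A) λ { (here refl) → b∉A a∈A }
    where
      singleton-independent : ∀ b → Independent (C-adj k) (b ∷ [])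
      singleton-independent b _ _ (here refl) (here refl) adjacent = adjacent⇒≢ b b adjacent refl

  C-existentially-complete : 1 ≤ k → ThreeExistentiallyComplete (C-adj k)
  C-existentially-complete k≥1 A (b ∷ B) _ short B⊆A independent =
    anchored-separation (b ∷ B) k≥1 independent (here refl) A short B⊆A
  C-existentially-complete k≥1 (a₁ ∷ a₂ ∷ a₃ ∷ []) [] ((a₁≢a₂ ∷ a₁≢a₃ ∷ []) ∷ (a₂≢a₃ ∷ []) ∷ _) _ _ _ =
    map₂ near⇒separates (near-point k k≥1 a₁ a₂ a₃ a₁≢a₂ a₁≢a₃ a₂≢a₃)
  C-existentially-complete k≥1 []                 [] _ _ _ _ = phantom-separation k≥1 _ z≤n
  C-existentially-complete k≥1 (_ ∷ [])           [] _ _ _ _ = phantom-separation k≥1 _ (s≤s z≤n)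
  C-existentially-complete k≥1 (_ ∷ _ ∷ [])       [] _ _ _ _ = phantom-separation k≥1 _ (s≤s (s≤s z≤n))
  C-existentially-complete k≥1 (_ ∷ _ ∷ _ ∷ _ ∷ _) [] _ (s≤s (s≤s (s≤s ()))) _ _

proposition8 : (k : ℕ) → 1 ≤ k → ThreeECTriangleFree (C-adj k)
proposition8 k k≥1 = C-triangle-free k , C-existentially-complete k k≥1
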